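{- Every $\mathfrak{G}(2)$-line Hoffman graph is a $\{\mathfrak{h}^{(3)},\mathfrak{q},\mathfrak{d}\}$-line Hoffman graph.
   Context: A Hoffman graph $\mathfrak{h}=(H,\ell)$ is a graph $H$ with a labelling of vertices as fat or slim such that no two fat vertices are adjacent and every fat vertex has a slim neighbour; it is $t$-fat if every slim vertex has at least $t$ fat neighbours. Its special matrix is $S(\mathfrak{h})=A_{\rm slim}-N^TN$, with $A_{\rm slim}$ the adjacency matrix of the subgraph induced on slim vertices and $N$ the fat-by-slim $0/1$ adjacency matrix. Induced Hoffman subgraphs are induced subgraphs with inherited labels; the one generated by a set $W$ of slim vertices is induced on $W$ plus all fat vertices adjacent to some vertex of $W$. A decomposition $\{\mathfrak{h}^i\}_{i=1}^r$ of $\mathfrak{h}$ is given by a partition $V^1,\dots,V^r$ of slim vertices with $\mathfrak{h}^i$ generated by $V^i$ and $S(\mathfrak{h})$ block diagonal w.r.t. the partition; $\mathfrak{h}$ is indecomposable if it has no decomposition with $r\ge2$. For a family $\mathfrak{G}$, $\mathfrak{h}$ is a $\mathfrak{G}$-line Hoffman graph if some Hoffman graph $\mathfrak{h}'$ with the same slim graph contains $\mathfrak{h}$ as an induced Hoffman subgraph and has a decomposition whose members are each isomorphic to an induced Hoffman subgraph of a member of $\mathfrak{G}$. $\mathfrak{G}(2)$ is the family of pairwise non-isomorphic indecomposable $2$-fat Hoffman graphs whose special matrix is either $(-3)$ or $\begin{pmatrix} J_{r_1} & -J_{r_1\times r_2}\\ -J_{r_2\times r_1} & J_{r_2}\end{pmatrix}-3I$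 with $r_1,r_2\in\{1,2\}$ ($J$ denoting all-ones matrices). $\mathfrak{h}^{(3)}$: one slim vertex adjacent to three fat vertices. $\mathfrak{d}$: two adjacent slim vertices and two fat vertices, each fat vertex adjacent to both slim vertices. $\mathfrak{q}$: four fat vertices $f_1,f_2,f_3,f_4$ and four slim vertices $s_1,s_2,s_3,s_4$ with $s_1\sim f_1,f_2$; $s_2\sim f_2,f_4$; $s_3\sim f_1,f_3$; $s_4\sim f_3,f_4$, and slim edges exactly $s_1s_4$ and $s_2s_3$. -}

module Defs where

open import Data.Nat using (ℕ; zero; suc; _+_; _≤_; _<ᵇ_)
open import Data.Fin using (Fin; zero; suc; toℕ)
open import Data.Fin.Properties using () renaming (_≟_ to _≟F_)
open import Data.Bool using (Bool; true; false; _∧_; if_then_else_; not)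
open import Data.Integer using (ℤ; +_; -_; _-_)
open import Data.List using (List; map; allFin)
open import Data.Nat.ListAction using (sum)
open import Data.Product using (Σ; ∃; _×_; _,_; proj₁; proj₂)
open import Data.Sum using (_⊎_)
open import Data.Unit using (⊤)
open import Relation.Nullary using (¬_; Dec; yes; no)
open import Relation.Binary.PropositionalEquality using (_≡_; _≢_; refl)
open import Function.Bundles using (_↔_; Inverse)

-- Slim vertices are Fin nS, fat vertices are Fin nF.
-- adj : slim-slim adjacency (a simple graph), fadj f s : fat f ~ slim s.
-- Fat vertices are never adjacent to each other (built into the encoding),
-- and every fat vertex has a slim neighbour.

record HoffmanGraph : Set where
  field
    nS nF        : ℕ
    adj          : Fin nS → Fin nS → Bool
    fadj         : Fin nF → Fin nS → Bool
    adj-sym      : ∀ i j → adj i j ≡ adj j i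
    adj-irrefl   : ∀ i → adj i i ≡ false
    fat-has-slim : ∀ f → ∃ λ s → fadj f s ≡ true
open HoffmanGraph public

b2ℕ : Bool → ℕ
b2ℕ true  = 1
b2ℕ false = 0

commonFat : (h : HoffmanGraph) → Fin (nS h) → Fin (nS h) → ℕ
commonFat h i j = sum (map (λ f → b2ℕ (fadj h f i ∧ fadj h f j)) (allFin (nF h)))

special : (h : HoffmanGraph) → Fin (nS h) → Fin (nS h) → ℤ
special h i j = (+ b2ℕ (adj h i j)) - (+ commonFat h i j)

Fat : ℕ → HoffmanGraph → Set
Fat t h = ∀ s → t ≤ commonFat h s s

-- Embeddings: the induced Hoffman subgraph of h on the slim vertices
-- satisfying P and fat vertices satisfying Q is isomorphic to an induced
-- Hoffman subgraph of g (label-preserving, adjacency preserving and reflecting,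
-- injective on vertices).

record Embedding (h : HoffmanGraph) (P : Fin (nS h) → Set) (Q : Fin (nF h) → Set)
                 (g : HoffmanGraph) : Set where
  field
    σ       : Σ (Fin (nS h)) P → Fin (nS g)
    τ       : Σ (Fin (nF h)) Q → Fin (nF g)
    σ-inj   : ∀ x y → σ x ≡ σ y → proj₁ x ≡ proj₁ y
    τ-inj   : ∀ x y → τ x ≡ τ y → proj₁ x ≡ proj₁ y
    adj-ok  : ∀ x y → adj g (σ x) (σ y) ≡ adj h (proj₁ x) (proj₁ y)
    fadj-ok : ∀ f x → fadj g (τ f) (σ x) ≡ fadj h (proj₁ f) (proj₁ x)

Whole : ∀ {A : Set} → A → Set
Whole _ = ⊤

record Decomposition (h : HoffmanGraph) (r : ℕ) : Set where
  field
    cls       : Fin (nS h) → Fin r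
    nonempty  : ∀ i → ∃ λ s → cls s ≡ i
    blockDiag : ∀ s t → cls s ≢ cls t → special h s t ≡ + 0

inPart : ∀ {h r} → Decomposition h r → Fin r → Fin (nS h) → Set
inPart d i s = Decomposition.cls d s ≡ i

fatOfPart : ∀ {h r} → Decomposition h r → Fin r → Fin (nF h) → Set
fatOfPart {h} d i f = ∃ λ s → Decomposition.cls d s ≡ i × fadj h f s ≡ true

Indecomposable : HoffmanGraph → Set
Indecomposable h = ∀ r → 2 ≤ r → ¬ Decomposition h r

-- A family of Hoffman graphs is given by a membership predicate
-- (graphs isomorphic to a member are then handled by using a closed predicate,
-- or embeddings).
Family : Set₁
Family = HoffmanGraph → Set

IsLine : Family → HoffmanGraph → Set
IsLine 𝔊 h =
  Σ HoffmanGraph λ h' →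
  Σ (Embedding h Whole Whole h') λ e →
    -- h' has the same slim graph as h: the slim part of the embedding is onto
    (∀ s' → ∃ λ s → Embedding.σ e s ≡ s') ×
  Σ ℕ λ r → Σ (Decomposition h' r) λ d →
    ∀ i → Σ HoffmanGraph λ g → 𝔊 g × Embedding h' (inPart d i) (fatOfPart d i) g

SpecialIs : (h : HoffmanGraph) (k : ℕ) → (Fin k → Fin k → ℤ) → Set
SpecialIs h k K = Σ (Fin (nS h) ↔ Fin k) λ π →
  ∀ i j → special h i j ≡ K (Inverse.to π i) (Inverse.to π j)

minus3 : Fin 1 → Fin 1 → ℤ
minus3 _ _ = - (+ 3)

blockMat : (r₁ r₂ : ℕ) → Fin (r₁ + r₂) → Fin (r₁ + r₂) → ℤ
blockMat r₁ r₂ i j =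
  (if sameSide then + 1 else - (+ 1)) - (if diag then + 3 else + 0)
  where
    side : Fin (r₁ + r₂) → Bool
    side x = toℕ x <ᵇ r₁
    sameSide : Bool
    sameSide with side i | side j
    ... | true  | true  = true
    ... | false | false = true
    ... | _     | _     = false
    diag : Bool
    diag with i ≟F j
    ... | yes _ = true
    ... | no  _ = false

OneOrTwo : ℕ → Set
OneOrTwo r = r ≡ 1 ⊎ r ≡ 2

G2 : Family
G2 h = Indecomposable h × Fat 2 h ×
  (SpecialIs h 1 minus3 ⊎
   Σ ℕ λ r₁ → Σ ℕ λ r₂ → OneOrTwo r₁ × OneOrTwo r₂ × SpecialIs h (r₁ + r₂) (blockMat r₁ r₂))

h3 : HoffmanGraph
h3 = record
  { nS = 1 ; nF = 3
  ; adj = λ _ _ → false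
  ; fadj = λ _ _ → true
  ; adj-sym = λ _ _ → refl
  ; adj-irrefl = λ _ → refl
  ; fat-has-slim = λ _ → zero , refl }

dAdj : Fin 2 → Fin 2 → Bool
dAdj zero zero = false
dAdj zero (suc zero) = true
dAdj (suc zero) zero = true
dAdj (suc zero) (suc zero) = false

dSym : ∀ i j → dAdj i j ≡ dAdj j i
dSym zero zero = refl
dSym zero (suc zero) = refl
dSym (suc zero) zero = refl
dSym (suc zero) (suc zero) = refl

dIrr : ∀ i → dAdj i i ≡ false
dIrr zero = refl
dIrr (suc zero) = refl

𝔡 : HoffmanGraph
𝔡 = record
  { nS = 2 ; nF = 2
  ; adj = dAdj
  ; fadj = λ _ _ → true
  ; adj-sym = dSym
  ; adj-irrefl = dIrr
  ; fat-has-slim = λ _ → zero , refl }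

-- 𝔮: slim s1..s4 = 0..3, fat f1..f4 = 0..3
-- s1~f1,f2; s2~f2,f4; s3~f1,f3; s4~f3,f4; slim edges s1s4, s2s3.
qAdj : Fin 4 → Fin 4 → Bool
qAdj zero (suc (suc (suc zero))) = true
qAdj (suc (suc (suc zero))) zero = true
qAdj (suc zero) (suc (suc zero)) = true
qAdj (suc (suc zero)) (suc zero) = true
qAdj _ _ = false

qSym : ∀ i j → qAdj i j ≡ qAdj j i
qSym zero zero = refl
qSym zero (suc zero) = refl
qSym zero (suc (suc zero)) = refl
qSym zero (suc (suc (suc zero))) = refl
qSym (suc zero) zero = refl
qSym (suc zero) (suc zero) = refl
qSym (suc zero) (suc (suc zero)) = refl
qSym (suc zero) (suc (suc (suc zero))) = refl
qSym (suc (suc zero)) zero = refl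
qSym (suc (suc zero)) (suc zero) = refl
qSym (suc (suc zero)) (suc (suc zero)) = refl
qSym (suc (suc zero)) (suc (suc (suc zero))) = refl
qSym (suc (suc (suc zero))) zero = refl
qSym (suc (suc (suc zero))) (suc zero) = refl
qSym (suc (suc (suc zero))) (suc (suc zero)) = refl
qSym (suc (suc (suc zero))) (suc (suc (suc zero))) = refl

qIrr : ∀ i → qAdj i i ≡ false
qIrr zero = refl
qIrr (suc zero) = refl
qIrr (suc (suc zero)) = refl
qIrr (suc (suc (suc zero))) = refl

qFadj : Fin 4 → Fin 4 → Bool
qFadj zero zero = true
qFadj zero (suc (suc zero)) = true
qFadj (suc zero) zero = true
qFadj (suc zero) (suc zero) = true
qFadj (suc (suc zero)) (suc (suc zero)) = true
qFadj (suc (suc zero)) (suc (suc (suc zero))) = true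
qFadj (suc (suc (suc zero))) (suc zero) = true
qFadj (suc (suc (suc zero))) (suc (suc (suc zero))) = true
qFadj _ _ = false

qFat : ∀ f → ∃ λ s → qFadj f s ≡ true
qFat zero = zero , refl
qFat (suc zero) = zero , refl
qFat (suc (suc zero)) = suc (suc zero) , refl
qFat (suc (suc (suc zero))) = suc zero , refl

𝔮 : HoffmanGraph
𝔮 = record
  { nS = 4 ; nF = 4
  ; adj = qAdj
  ; fadj = qFadj
  ; adj-sym = qSym
  ; adj-irrefl = qIrr
  ; fat-has-slim = qFat }

-- the family {𝔥⁽³⁾, 𝔮, 𝔡} (membership up to isomorphism is irrelevant for
-- IsLine since only embeddings into members are used)
HQD : Family
HQD g = g ≡ h3 ⊎ g ≡ 𝔮 ⊎ g ≡ 𝔡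

-- It suffices to embed every member g of 𝔊(2) into 𝔥⁽³⁾, 𝔮 or 𝔡: such embeddings
-- compose with those of the parts of a decomposition.  An entry of S(g) fixes the
-- adjacency and the number of common fat neighbours of two slim vertices.  On the
-- diagonal, -3 or -2 says that a slim vertex has three or two fat neighbours.  An
-- entry 1 is an edge whose ends have no common fat neighbour; in the 2+1 and 2+2
-- blocks every slim vertex on the other side meets each end in exactly one fat vertex, so
-- the two ends split the fat vertices between them.  A fat vertex is then determined
-- by its adjacency to one end and to one vertex of the other side, and these two bits
-- name a fat vertex of 𝔮.  For the 1+1 block, the -1 off the diagonal is either a
-- non-edge with one common fat neighbour (inside 𝔮) or an edge with both fat
-- neighbours in common (𝔡).
module Submission where

open import Defs
open import Data.Bool using (Bool; true; false; not; _∧_)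
open import Data.Empty using (⊥; ⊥-elim)
open import Data.Fin using (Fin; zero; suc; toℕ; inject≤; inject₁)
open import Data.Fin.Patterns using (0F; 1F; 2F; 3F)
open import Data.Fin.Permutation using (transpose; _⟨$⟩ʳ_)
open import Data.Fin.Properties using (_≟_; inject≤-injective; inject₁-injective)
open import Data.Fin.Subset using (Subset; _∈_; _∉_; _⊆_; _∩_; _-_; ⊤; ∣_∣; Nonempty)
open import Data.Fin.Subset.Properties
  using ( x∈p⇒∣p-x∣<∣p∣; x∈p∧x≢y⇒x∈p-y; p⊆q⇒∣p∣≤∣q∣; x∈p∩q⁺; x∈p∩q⁻; _∈?_; nonempty?
        ; Empty-unique; ∣⊥∣≡0; ∣⊤∣≡n; ∩-comm; ∩-idem)
open import Data.Integer using (ℤ; +_; -[1+_]; 1ℤ; -1ℤ) renaming (_-_ to _-ℤ_)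
import Data.List as List
open import Data.List.Properties using (map-tabulate)
open import Data.Nat using (ℕ; zero; suc; _+_; _≤_; _<_; z≤n; z<s; s≤s; _<ᵇ_)
open import Data.Nat.ListAction using (sum)
open import Data.Nat.Properties using (≤-<-trans; <⇒≱; <⇒≢; ≤-reflexive)
open import Data.Product using (Σ; ∃; _×_; _,_; proj₁; proj₂)
open import Data.Sum using (_⊎_; inj₁; inj₂)
open import Data.Unit using (tt)
open import Data.Vec using (tabulate)
open import Data.Vec.Properties using (lookup∘tabulate; []=⇒lookup; lookup⇒[]=)
open import Function using (_∘_; id)
open import Function.Bundles using (Inverse)
open import Function.Construct.Composition using (_↔-∘_)
open import Function.Definitions using (Injective)
open import Function.Consequences.Propositional using (inverseʳ⇒injective; strictlyInverseʳ⇒inverseʳ)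
open import Relation.Binary.PropositionalEquality
  using (_≡_; _≢_; refl; sym; trans; cong; cong₂; subst; subst₂)
open import Relation.Nullary using (yes; no)
open import Relation.Nullary.Decidable using (decidable-stable)

private variable
  n : ℕ
  p q : Subset n
  x y z : Fin n

x∈p⇒0<∣p∣ : x ∈ p → 0 < ∣ p ∣
x∈p⇒0<∣p∣ x∈p = ≤-<-trans z≤n (x∈p⇒∣p-x∣<∣p∣ x∈p)

x∈p∧y∈p∧x≢y⇒1<∣p∣ : x ∈ p → y ∈ p → x ≢ y → 1 < ∣ p ∣
x∈p∧y∈p∧x≢y⇒1<∣p∣ x∈p y∈p x≢y =
  ≤-<-trans (x∈p⇒0<∣p∣ (x∈p∧x≢y⇒x∈p-y y∈p (x≢y ∘ sym))) (x∈p⇒∣p-x∣<∣p∣ x∈p)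

x∈p∧y∈p∧z∈p⇒2<∣p∣ : x ∈ p → y ∈ p → z ∈ p → x ≢ y → x ≢ z → y ≢ z → 2 < ∣ p ∣
x∈p∧y∈p∧z∈p⇒2<∣p∣ x∈p y∈p z∈p x≢y x≢z y≢z =
  ≤-<-trans (x∈p∧y∈p∧x≢y⇒1<∣p∣ (x∈p∧x≢y⇒x∈p-y y∈p (x≢y ∘ sym))
                                (x∈p∧x≢y⇒x∈p-y z∈p (x≢z ∘ sym)) y≢z)
            (x∈p⇒∣p-x∣<∣p∣ x∈p)

∣p∣≤1⇒∈-unique : ∣ p ∣ ≤ 1 → x ∈ p → y ∈ p → x ≡ y
∣p∣≤1⇒∈-unique ∣p∣≤1 x∈p y∈p =
  decidable-stable (_ ≟ _) λ x≢y → <⇒≱ (x∈p∧y∈p∧x≢y⇒1<∣p∣ x∈p y∈p x≢y) ∣p∣≤1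

∣p∣≤2⇒∈-one-of : ∣ p ∣ ≤ 2 → x ∈ p → y ∈ p → x ≢ y → z ∈ p → z ≡ x ⊎ z ≡ y
∣p∣≤2⇒∈-one-of {x = x} {y} {z} ∣p∣≤2 x∈p y∈p x≢y z∈p with z ≟ x | z ≟ y
... | yes z≡x | _       = inj₁ z≡x
... | no _    | yes z≡y = inj₂ z≡y
... | no z≢x  | no z≢y  =
  ⊥-elim (<⇒≱ (x∈p∧y∈p∧z∈p⇒2<∣p∣ x∈p y∈p z∈p x≢y (z≢x ∘ sym) (z≢y ∘ sym)) ∣p∣≤2)

0<∣p∣⇒Nonempty : ∀ {n} {p : Subset n} → 0 < ∣ p ∣ → Nonempty p
0<∣p∣⇒Nonempty {n} {p} 0<∣p∣ = decidable-stable (nonempty? p) λ empty →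
  <⇒≢ 0<∣p∣ (sym (trans (cong ∣_∣ (Empty-unique empty)) (∣⊥∣≡0 n)))

∣p∣≤∣p∩q∣⇒p⊆q : ∣ p ∣ ≤ ∣ p ∩ q ∣ → p ⊆ q
∣p∣≤∣p∩q∣⇒p⊆q {p = p} {q} ∣p∣≤∣p∩q∣ {x} x∈p = decidable-stable (x ∈? q) λ x∉q →
  <⇒≱ (≤-<-trans (p⊆q⇒∣p∣≤∣q∣ (p∩q⊆p-x x∉q)) (x∈p⇒∣p-x∣<∣p∣ x∈p)) ∣p∣≤∣p∩q∣
  where
  p∩q⊆p-x : x ∉ q → p ∩ q ⊆ p - x
  p∩q⊆p-x x∉q y∈p∩q with x∈p∩q⁻ p q y∈p∩q
  ... | y∈p , y∈q = x∈p∧x≢y⇒x∈p-y y∈p λ { refl → x∉q y∈q }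

∈-tabulate⁺ : {a : Fin n → Bool} → a x ≡ true → x ∈ tabulate a
∈-tabulate⁺ {x = x} {a} ax≡true = lookup⇒[]= x (tabulate a) (trans (lookup∘tabulate a x) ax≡true)

∈-tabulate⁻ : {a : Fin n → Bool} → x ∈ tabulate a → a x ≡ true
∈-tabulate⁻ {x = x} {a} x∈a = trans (sym (lookup∘tabulate a x)) ([]=⇒lookup x∈a)

∣tabulate∩tabulate∣ : (a b : Fin n → Bool) →
  ∣ tabulate a ∩ tabulate b ∣ ≡ sum (List.tabulate (λ x → b2ℕ (a x ∧ b x)))
∣tabulate∩tabulate∣ {zero}  a b = refl
∣tabulate∩tabulate∣ {suc n} a b with a zero ∧ b zero
... | true  = cong suc (∣tabulate∩tabulate∣ (a ∘ suc) (b ∘ suc))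
... | false = ∣tabulate∩tabulate∣ (a ∘ suc) (b ∘ suc)

fatNeighbours : (h : HoffmanGraph) → Fin (nS h) → Subset (nF h)
fatNeighbours h s = tabulate (λ f → fadj h f s)

Complementary : (h : HoffmanGraph) → Fin (nS h) → Fin (nS h) → Set
Complementary h s t = ∀ f → fadj h f t ≡ not (fadj h f s)

module HoffmanGraphProperties (h : HoffmanGraph) where

  private variable
    s t t′ : Fin (nS h)
    f f′ : Fin (nF h)
    m : ℕ

  commonFat≡∣∩∣ : ∀ s t → commonFat h s t ≡ ∣ fatNeighbours h s ∩ fatNeighbours h t ∣
  commonFat≡∣∩∣ s t =
    trans (cong sum (map-tabulate id (λ f → b2ℕ (fadj h f s ∧ fadj h f t))))
          (sym (∣tabulate∩tabulate∣ (λ f → fadj h f s) (λ f → fadj h f t)))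

  commonFat-sym : ∀ s t → commonFat h s t ≡ commonFat h t s
  commonFat-sym s t =
    trans (commonFat≡∣∩∣ s t)
          (trans (cong ∣_∣ (∩-comm (fatNeighbours h s) (fatNeighbours h t))) (sym (commonFat≡∣∩∣ t s)))

  private
    ∈-common : fadj h f s ≡ true → fadj h f t ≡ true →
               f ∈ fatNeighbours h s ∩ fatNeighbours h t
    ∈-common fs ft = x∈p∩q⁺ (∈-tabulate⁺ fs , ∈-tabulate⁺ ft)

    ∣common∣≤ : commonFat h s t ≡ m → ∣ fatNeighbours h s ∩ fatNeighbours h t ∣ ≤ m
    ∣common∣≤ {s} {t} c≡m = ≤-reflexive (trans (sym (commonFat≡∣∩∣ s t)) c≡m)

  no-common-fat : commonFat h s t ≡ 0 → fadj h f s ≡ true → fadj h f t ≡ true → ⊥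
  no-common-fat c≡0 fs ft = <⇒≱ (x∈p⇒0<∣p∣ (∈-common fs ft)) (∣common∣≤ c≡0)

  unique-common-fat : commonFat h s t ≡ 1 →
                      fadj h f s ≡ true → fadj h f t ≡ true →
                      fadj h f′ s ≡ true → fadj h f′ t ≡ true → f ≡ f′
  unique-common-fat c≡1 fs ft f′s f′t =
    ∣p∣≤1⇒∈-unique (∣common∣≤ c≡1) (∈-common fs ft) (∈-common f′s f′t)

  common-fat : commonFat h s t ≡ suc m → ∃ λ f → fadj h f s ≡ true × fadj h f t ≡ true
  common-fat {s} {t} c≡suc
    with 0<∣p∣⇒Nonempty (subst (0 <_) (trans (sym c≡suc) (commonFat≡∣∩∣ s t)) z<s)
  ... | f , f∈ with x∈p∩q⁻ _ _ f∈
  ...   | f∈s , f∈t = f , ∈-tabulate⁻ f∈s , ∈-tabulate⁻ f∈t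

  one-of-two-fat : commonFat h s s ≡ 2 → f ≢ f′ →
                   fadj h f s ≡ true → fadj h f′ s ≡ true → ∀ {f″} → fadj h f″ s ≡ true →
                   f″ ≡ f ⊎ f″ ≡ f′
  one-of-two-fat c≡2 f≢f′ fs f′s f″s =
    ∣p∣≤2⇒∈-one-of (∣common∣≤ c≡2) (∈-common fs fs) (∈-common f′s f′s) f≢f′ (∈-common f″s f″s)

  fatNeighbours-⊆ : commonFat h s s ≤ commonFat h s t → fadj h f s ≡ true → fadj h f t ≡ true
  fatNeighbours-⊆ {s} {t} css≤cst fs =
    ∈-tabulate⁻ (∣p∣≤∣p∩q∣⇒p⊆q {p = fatNeighbours h s} {fatNeighbours h t}
                                ∣Ns∣≤∣Ns∩Nt∣ (∈-tabulate⁺ fs))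
    where
    ∣Ns∣≤∣Ns∩Nt∣ : ∣ fatNeighbours h s ∣ ≤ ∣ fatNeighbours h s ∩ fatNeighbours h t ∣
    ∣Ns∣≤∣Ns∩Nt∣ = subst₂ _≤_ (trans (commonFat≡∣∩∣ s s) (cong ∣_∣ (∩-idem (fatNeighbours h s))))
                              (commonFat≡∣∩∣ s t) css≤cst

  nF≤commonFat : (∀ f → fadj h f s ≡ true) → nF h ≤ commonFat h s s
  nF≤commonFat {s} adjacent = subst₂ _≤_ (∣⊤∣≡n (nF h)) (sym (commonFat≡∣∩∣ s s))
    (p⊆q⇒∣p∣≤∣q∣ {p = ⊤} λ {f} _ → ∈-common (adjacent f) (adjacent f))

  special≡1ℤ : special h s t ≡ 1ℤ → adj h s t ≡ true × commonFat h s t ≡ 0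
  special≡1ℤ {s} {t} = entry (adj h s t) (commonFat h s t)
    where
    entry : ∀ a c → + b2ℕ a -ℤ + c ≡ 1ℤ → a ≡ true × c ≡ 0
    entry true  zero          _ = refl , refl
    entry true  (suc zero)    ()
    entry true  (suc (suc c)) ()
    entry false zero          ()
    entry false (suc c)       ()

  special≡-1ℤ : special h s t ≡ -1ℤ →
                adj h s t ≡ false × commonFat h s t ≡ 1 ⊎ adj h s t ≡ true × commonFat h s t ≡ 2
  special≡-1ℤ {s} {t} = entry (adj h s t) (commonFat h s t)
    where
    entry : ∀ a c → + b2ℕ a -ℤ + c ≡ -1ℤ → a ≡ false × c ≡ 1 ⊎ a ≡ true × c ≡ 2
    entry false (suc zero)          _ = inj₁ (refl , refl)
    entry true  (suc (suc zero))    _ = inj₂ (refl , refl)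
    entry false zero                ()
    entry false (suc (suc c))       ()
    entry true  zero                ()
    entry true  (suc zero)          ()
    entry true  (suc (suc (suc c))) ()

  special-diagonal : special h s s ≡ -[1+ m ] → commonFat h s s ≡ suc m
  special-diagonal {s} {m} e =
    entry (commonFat h s s)
          (subst (λ a → + b2ℕ a -ℤ + commonFat h s s ≡ -[1+ m ]) (adj-irrefl h s) e)
    where
    entry : ∀ c → + 0 -ℤ + c ≡ -[1+ m ] → c ≡ suc m
    entry (suc c) refl = refl

  special≡-1ℤ⇒common-fat : special h s t ≡ -1ℤ → ∃ λ f → fadj h f s ≡ true × fadj h f t ≡ true
  special≡-1ℤ⇒common-fat e with special≡-1ℤ e
  ... | inj₁ (_ , c≡1) = common-fat c≡1
  ... | inj₂ (_ , c≡2) = common-fat c≡2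

  private
    distinguished-by : fadj h f t ≡ true → fadj h f′ t ≡ false → f ≢ f′
    distinguished-by ft f′t refl with trans (sym ft) f′t
    ... | ()

  same-trace⇒≡ : commonFat h s s ≡ 2 → commonFat h s t ≡ 1 →
                 fadj h f s ≡ true → fadj h f′ s ≡ true → fadj h f t ≡ fadj h f′ t → f ≡ f′
  same-trace⇒≡ {t = t} {f = f} css≡2 cst≡1 fs f′s ft≡f′t with fadj h f t in ft
  ... | true  = unique-common-fat cst≡1 fs ft f′s (sym ft≡f′t)
  ... | false with common-fat cst≡1
  ...   | x , xs , xt with one-of-two-fat css≡2 (distinguished-by xt ft) xs fs f′s
  ...     | inj₁ refl = ⊥-elim (distinguished-by xt (sym ft≡f′t) refl)
  ...     | inj₂ f′≡f = sym f′≡f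

  same-trace⇒≡-complementary : Complementary h s t → commonFat h s s ≡ 2 → commonFat h t t ≡ 2 →
                               commonFat h s t′ ≡ 1 → commonFat h t t′ ≡ 1 →
                               fadj h f s ≡ fadj h f′ s → fadj h f t′ ≡ fadj h f′ t′ → f ≡ f′
  same-trace⇒≡-complementary {s} {f = f} {f′} comp css≡2 ctt≡2 cst′≡1 ctt′≡1 fs≡f′s ft′≡f′t′
    with fadj h f s in fs
  ... | true  = same-trace⇒≡ css≡2 cst′≡1 fs (sym fs≡f′s) ft′≡f′t′
  ... | false = same-trace⇒≡ ctt≡2 ctt′≡1 (trans (comp f) (cong not fs))
                  (trans (comp f′) (cong not (sym fs≡f′s))) ft′≡f′t′

  special≡-1ℤ⇒nonadjacent : commonFat h s s ≡ 2 → commonFat h t t′ ≡ 0 →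
                            special h s t ≡ -1ℤ → special h s t′ ≡ -1ℤ →
                            adj h s t ≡ false × commonFat h s t ≡ 1
  special≡-1ℤ⇒nonadjacent css≡2 ctt′≡0 st≡-1 st′≡-1 with special≡-1ℤ st≡-1
  ... | inj₁ nonadjacent = nonadjacent
  ... | inj₂ (_ , cst≡2) with special≡-1ℤ⇒common-fat st′≡-1
  ...   | f , fs , ft′ =
    ⊥-elim (no-common-fat ctt′≡0 (fatNeighbours-⊆ (≤-reflexive (trans css≡2 (sym cst≡2))) fs) ft′)

  covered-by : commonFat h s s ≡ 2 → commonFat h s t ≡ 1 → commonFat h s t′ ≡ 1 →
               commonFat h t t′ ≡ 0 → fadj h f s ≡ true → fadj h f t ≡ true ⊎ fadj h f t′ ≡ true
  covered-by css≡2 cst≡1 cst′≡1 ctt′≡0 fs with common-fat cst≡1 | common-fat cst′≡1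
  ... | x , xs , xt | y , ys , yt′
    with one-of-two-fat css≡2 (λ { refl → no-common-fat ctt′≡0 xt yt′ }) xs ys fs
  ...   | inj₁ refl = inj₁ xt
  ...   | inj₂ refl = inj₂ yt′

  complementary : commonFat h s t ≡ 0 → (∀ f → fadj h f s ≡ true ⊎ fadj h f t ≡ true) →
                  Complementary h s t
  complementary {s} {t} cst≡0 covered f with fadj h f s in fs | fadj h f t in ft | covered f
  ... | true  | true  | _       = ⊥-elim (no-common-fat cst≡0 fs ft)
  ... | true  | false | _       = refl
  ... | false | true  | _       = refl
  ... | false | false | inj₁ ()
  ... | false | false | inj₂ ()

EmbedsIn : Family → HoffmanGraph → Set
EmbedsIn 𝔊 g = Σ HoffmanGraph λ t → 𝔊 t × Embedding g Whole Whole t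

Embedding-trans : ∀ {h P Q g t} → Embedding h P Q g → Embedding g Whole Whole t → Embedding h P Q t
Embedding-trans e₁ e₂ = record
  { σ       = λ x → E₂.σ (E₁.σ x , tt)
  ; τ       = λ f → E₂.τ (E₁.τ f , tt)
  ; σ-inj   = λ x y → E₁.σ-inj x y ∘ E₂.σ-inj _ _
  ; τ-inj   = λ x y → E₁.τ-inj x y ∘ E₂.τ-inj _ _
  ; adj-ok  = λ x y → trans (E₂.adj-ok _ _) (E₁.adj-ok x y)
  ; fadj-ok = λ f x → trans (E₂.fadj-ok _ _) (E₁.fadj-ok f x)
  }
  where
  module E₁ = Embedding e₁
  module E₂ = Embedding e₂

IsLine-mono : ∀ {𝔊 𝔊′} → (∀ {g} → 𝔊 g → EmbedsIn 𝔊′ g) → ∀ {h} → IsLine 𝔊 h → IsLine 𝔊′ h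
IsLine-mono 𝔊⊑𝔊′ (h′ , e , onto , r , d , parts) = h′ , e , onto , r , d , λ i →
  let (g , g∈𝔊 , part↪g) = parts i
      (t , t∈𝔊′ , g↪t)   = 𝔊⊑𝔊′ g∈𝔊
  in t , t∈𝔊′ , Embedding-trans part↪g g↪t

𝔮-fat : Bool → Bool → Fin 4
𝔮-fat true  false = 0F
𝔮-fat true  true  = 1F
𝔮-fat false false = 2F
𝔮-fat false true  = 3F

𝔮-fat-adjacency : ∀ a b → qFadj (𝔮-fat a b) 0F ≡ a × qFadj (𝔮-fat a b) 1F ≡ b ×
                          qFadj (𝔮-fat a b) 2F ≡ not b × qFadj (𝔮-fat a b) 3F ≡ not a
𝔮-fat-adjacency true  false = refl , refl , refl , refl
𝔮-fat-adjacency true  true  = refl , refl , refl , refl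
𝔮-fat-adjacency false false = refl , refl , refl , refl
𝔮-fat-adjacency false true  = refl , refl , refl , refl

𝔮-fat-injective : ∀ {a b a′ b′} → 𝔮-fat a b ≡ 𝔮-fat a′ b′ → a ≡ a′ × b ≡ b′
𝔮-fat-injective {a} {b} {a′} {b′} e =
  trans (sym (proj₁ (𝔮-fat-adjacency a b)))
        (trans (cong (λ f → qFadj f 0F) e) (proj₁ (𝔮-fat-adjacency a′ b′))) ,
  trans (sym (proj₁ (proj₂ (𝔮-fat-adjacency a b))))
        (trans (cong (λ f → qFadj f 1F) e) (proj₁ (proj₂ (𝔮-fat-adjacency a′ b′))))

module Indexed {g : HoffmanGraph} {k : ℕ} (K : Fin k → Fin k → ℤ) (si : SpecialIs g k K) where

  private
    index : Fin (nS g) → Fin k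
    index = Inverse.to (proj₁ si)

  vertex : Fin k → Fin (nS g)
  vertex = Inverse.from (proj₁ si)

  private
    vertex-index : ∀ s → vertex (index s) ≡ s
    vertex-index = Inverse.strictlyInverseʳ (proj₁ si)

  special-vertex : ∀ i j → special g (vertex i) (vertex j) ≡ K i j
  special-vertex i j = trans (proj₂ si (vertex i) (vertex j))
    (cong₂ K (Inverse.strictlyInverseˡ (proj₁ si) i) (Inverse.strictlyInverseˡ (proj₁ si) j))

  slim-neighbour : ∀ f → ∃ λ i → fadj g f (vertex i) ≡ true
  slim-neighbour f with fat-has-slim g f
  ... | s , fs = index s , subst (λ s → fadj g f s ≡ true) (sym (vertex-index s)) fs

  embedding : (t : HoffmanGraph)
              (φ : Fin k → Fin (nS t)) → Injective _≡_ _≡_ φ →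
              (τ : Fin (nF g) → Fin (nF t)) → Injective _≡_ _≡_ τ →
              (∀ i j → adj t (φ i) (φ j) ≡ adj g (vertex i) (vertex j)) →
              (∀ f i → fadj t (τ f) (φ i) ≡ fadj g f (vertex i)) →
              Embedding g Whole Whole t
  embedding t φ φ-inj τ τ-inj adj-φ fadj-τφ = record
    { σ       = φ ∘ index ∘ proj₁
    ; τ       = τ ∘ proj₁
    ; σ-inj   = λ (x , _) (y , _) e →
        trans (sym (vertex-index x)) (trans (cong vertex (φ-inj e)) (vertex-index y))
    ; τ-inj   = λ _ _ → τ-inj
    ; adj-ok  = λ (x , _) (y , _) →
        trans (adj-φ (index x) (index y)) (cong₂ (adj g) (vertex-index x) (vertex-index y))
    ; fadj-ok = λ (f , _) (x , _) → trans (fadj-τφ f (index x)) (cong (fadj g f) (vertex-index x))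
    }

  𝔮-embedding : (φ : Fin k → Fin 4) → Injective _≡_ _≡_ φ →
                (a b : Fin (nF g) → Bool) → (∀ {f f′} → a f ≡ a f′ → b f ≡ b f′ → f ≡ f′) →
                (∀ i j → qAdj (φ i) (φ j) ≡ adj g (vertex i) (vertex j)) →
                (∀ f i → qFadj (𝔮-fat (a f) (b f)) (φ i) ≡ fadj g f (vertex i)) →
                Embedding g Whole Whole 𝔮
  𝔮-embedding φ φ-inj a b ab-inj = embedding 𝔮 φ φ-inj (λ f → 𝔮-fat (a f) (b f))
    (λ e → let (a≡ , b≡) = 𝔮-fat-injective e in ab-inj a≡ b≡)

blockMat-diagonal : ∀ r₁ r₂ i → blockMat r₁ r₂ i i ≡ -[1+ 1 ]
blockMat-diagonal r₁ r₂ i with toℕ i <ᵇ r₁ | i ≟ i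
... | true  | yes _  = refl
... | false | yes _  = refl
... | _     | no i≢i = ⊥-elim (i≢i refl)

module Block {g : HoffmanGraph} (r₁ r₂ : ℕ) (si : SpecialIs g (r₁ + r₂) (blockMat r₁ r₂)) where
  open Indexed {g} (blockMat r₁ r₂) si public
  open HoffmanGraphProperties g public

  two-fat : ∀ i → commonFat g (vertex i) (vertex i) ≡ 2
  two-fat i = special-diagonal (trans (special-vertex i i) (blockMat-diagonal r₁ r₂ i))

module SpecialMinus3 {g : HoffmanGraph} (si : SpecialIs g 1 minus3) where
  open Indexed {g} minus3 si
  open HoffmanGraphProperties g

  adjacent-to-vertex : ∀ f → fadj g f (vertex 0F) ≡ true
  adjacent-to-vertex f with slim-neighbour f
  ... | 0F , f0 = f0

  nF≤3 : nF g ≤ 3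
  nF≤3 = subst (nF g ≤_) (special-diagonal (special-vertex 0F 0F)) (nF≤commonFat adjacent-to-vertex)

  h3-embedding : Embedding g Whole Whole h3
  h3-embedding = embedding h3 id id (λ f → inject≤ f nF≤3) (inject≤-injective _ _ _ _)
    (λ { 0F 0F → sym (adj-irrefl g _) }) (λ { f 0F → sym (adjacent-to-vertex f) })

module SpecialBlock11 {g : HoffmanGraph} (si : SpecialIs g 2 (blockMat 1 1)) where
  open Block {g} 1 1 si

  path-embedding : adj g (vertex 0F) (vertex 1F) ≡ false → commonFat g (vertex 0F) (vertex 1F) ≡ 1 →
                   Embedding g Whole Whole 𝔮
  path-embedding nonadjacent c₀₁≡1 =
    𝔮-embedding φ (inject≤-injective _ _ _ _)
      (λ f → fadj g f (vertex 0F)) (λ f → fadj g f (vertex 1F)) same-trace adjacency fat-adjacency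
    where
    φ : Fin 2 → Fin 4
    φ i = inject≤ i (s≤s (s≤s z≤n))

    adjacent-to-1 : ∀ {f} → fadj g f (vertex 0F) ≡ false → fadj g f (vertex 1F) ≡ true
    adjacent-to-1 {f} f0 with slim-neighbour f
    ... | 1F , f1 = f1
    ... | 0F , f0′ with trans (sym f0′) f0
    ...   | ()

    same-trace : ∀ {f f′} → fadj g f (vertex 0F) ≡ fadj g f′ (vertex 0F) →
                 fadj g f (vertex 1F) ≡ fadj g f′ (vertex 1F) → f ≡ f′
    same-trace {f} e₀ e₁ with fadj g f (vertex 0F) in f0
    ... | true  = same-trace⇒≡ (two-fat 0F) c₀₁≡1 f0 (sym e₀) e₁
    ... | false = same-trace⇒≡ (two-fat 1F) (trans (commonFat-sym _ _) c₀₁≡1)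
                    (adjacent-to-1 f0) (adjacent-to-1 (sym e₀)) (trans f0 e₀)

    adjacency : ∀ i j → qAdj (φ i) (φ j) ≡ adj g (vertex i) (vertex j)
    adjacency 0F 0F = sym (adj-irrefl g _)
    adjacency 0F 1F = sym nonadjacent
    adjacency 1F 0F = sym (trans (adj-sym g _ _) nonadjacent)
    adjacency 1F 1F = sym (adj-irrefl g _)

    fat-adjacency : ∀ f i → qFadj (𝔮-fat (fadj g f (vertex 0F)) (fadj g f (vertex 1F))) (φ i) ≡
                            fadj g f (vertex i)
    fat-adjacency f 0F = proj₁ (𝔮-fat-adjacency _ _)
    fat-adjacency f 1F = proj₁ (proj₂ (𝔮-fat-adjacency _ _))

  𝔡-embedding : adj g (vertex 0F) (vertex 1F) ≡ true → commonFat g (vertex 0F) (vertex 1F) ≡ 2 →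
                Embedding g Whole Whole 𝔡
  𝔡-embedding adjacent c₀₁≡2 = embedding 𝔡 id id (λ f → inject≤ f nF≤2) (inject≤-injective _ _ _ _)
    adjacency λ { f 0F → sym (proj₁ (adjacent-to-both f)) ; f 1F → sym (proj₂ (adjacent-to-both f)) }
    where
    N₀⊆N₁ : ∀ {f} → fadj g f (vertex 0F) ≡ true → fadj g f (vertex 1F) ≡ true
    N₀⊆N₁ = fatNeighbours-⊆ (≤-reflexive (trans (two-fat 0F) (sym c₀₁≡2)))

    N₁⊆N₀ : ∀ {f} → fadj g f (vertex 1F) ≡ true → fadj g f (vertex 0F) ≡ true
    N₁⊆N₀ = fatNeighbours-⊆ (≤-reflexive (trans (two-fat 1F) (sym (trans (commonFat-sym _ _) c₀₁≡2))))

    adjacent-to-both : ∀ f → fadj g f (vertex 0F) ≡ true × fadj g f (vertex 1F) ≡ true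
    adjacent-to-both f with slim-neighbour f
    ... | 0F , f0 = f0 , N₀⊆N₁ f0
    ... | 1F , f1 = N₁⊆N₀ f1 , f1

    nF≤2 : nF g ≤ 2
    nF≤2 = subst (nF g ≤_) (two-fat 0F) (nF≤commonFat (proj₁ ∘ adjacent-to-both))

    adjacency : ∀ i j → dAdj i j ≡ adj g (vertex i) (vertex j)
    adjacency 0F 0F = sym (adj-irrefl g _)
    adjacency 0F 1F = sym adjacent
    adjacency 1F 0F = sym (trans (adj-sym g _ _) adjacent)
    adjacency 1F 1F = sym (adj-irrefl g _)

  embeds-in-HQD : EmbedsIn HQD g
  embeds-in-HQD with special≡-1ℤ (special-vertex 0F 1F)
  ... | inj₁ (nonadjacent , c₀₁≡1) = 𝔮 , inj₂ (inj₁ refl) , path-embedding nonadjacent c₀₁≡1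
  ... | inj₂ (adjacent , c₀₁≡2)    = 𝔡 , inj₂ (inj₂ refl) , 𝔡-embedding adjacent c₀₁≡2

module EdgeBlock {g : HoffmanGraph} (r : ℕ) (si : SpecialIs g (2 + suc r) (blockMat 2 (suc r))) where
  open Block {g} 2 (suc r) si public

  edge₀₁ : adj g (vertex 0F) (vertex 1F) ≡ true × commonFat g (vertex 0F) (vertex 1F) ≡ 0
  edge₀₁ = special≡1ℤ (special-vertex 0F 1F)

  module Opposite (i : Fin (2 + suc r)) (i0≡-1 : special g (vertex i) (vertex 0F) ≡ -1ℤ)
                  (i1≡-1 : special g (vertex i) (vertex 1F) ≡ -1ℤ) where

    meets₀ : adj g (vertex i) (vertex 0F) ≡ false × commonFat g (vertex i) (vertex 0F) ≡ 1
    meets₀ = special≡-1ℤ⇒nonadjacent (two-fat i) (proj₂ edge₀₁) i0≡-1 i1≡-1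

    meets₁ : adj g (vertex i) (vertex 1F) ≡ false × commonFat g (vertex i) (vertex 1F) ≡ 1
    meets₁ = special≡-1ℤ⇒nonadjacent (two-fat i) (trans (commonFat-sym _ _) (proj₂ edge₀₁)) i1≡-1 i0≡-1

    covered : ∀ {f} → fadj g f (vertex i) ≡ true →
              fadj g f (vertex 0F) ≡ true ⊎ fadj g f (vertex 1F) ≡ true
    covered = covered-by (two-fat i) (proj₂ meets₀) (proj₂ meets₁) (proj₂ edge₀₁)

  open Opposite 2F (special-vertex 2F 0F) (special-vertex 2F 1F) public
    renaming (meets₀ to meets₂₀; meets₁ to meets₂₁; covered to covered₂)

  trace₀₂-injective : Complementary g (vertex 0F) (vertex 1F) → ∀ {f f′} →
                      fadj g f (vertex 0F) ≡ fadj g f′ (vertex 0F) →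
                      fadj g f (vertex 2F) ≡ fadj g f′ (vertex 2F) → f ≡ f′
  trace₀₂-injective complement = same-trace⇒≡-complementary complement (two-fat 0F) (two-fat 1F)
    (trans (commonFat-sym _ _) (proj₂ meets₂₀)) (trans (commonFat-sym _ _) (proj₂ meets₂₁))

-- Lists the slim vertices of 𝔮 as s₁, s₄, s₂, s₃, the order in which S(𝔮) is blockMat 2 2.
𝔮-slim : Fin 4 → Fin 4
𝔮-slim 0F = 0F
𝔮-slim 1F = 3F
𝔮-slim 2F = 1F
𝔮-slim 3F = 2F

𝔮-slim-injective : Injective _≡_ _≡_ 𝔮-slim
𝔮-slim-injective =
  inverseʳ⇒injective 𝔮-slim (strictlyInverseʳ⇒inverseʳ {f⁻¹ = 𝔮-slim⁻¹} 𝔮-slim 𝔮-slim⁻¹∘𝔮-slim)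
  where
  𝔮-slim⁻¹ : Fin 4 → Fin 4
  𝔮-slim⁻¹ 0F = 0F
  𝔮-slim⁻¹ 1F = 2F
  𝔮-slim⁻¹ 2F = 3F
  𝔮-slim⁻¹ 3F = 1F

  𝔮-slim⁻¹∘𝔮-slim : ∀ i → 𝔮-slim⁻¹ (𝔮-slim i) ≡ i
  𝔮-slim⁻¹∘𝔮-slim 0F = refl
  𝔮-slim⁻¹∘𝔮-slim 1F = refl
  𝔮-slim⁻¹∘𝔮-slim 2F = refl
  𝔮-slim⁻¹∘𝔮-slim 3F = refl

module SpecialBlock21 {g : HoffmanGraph} (si : SpecialIs g 3 (blockMat 2 1)) where
  open EdgeBlock {g} 0 si

  complement₀₁ : Complementary g (vertex 0F) (vertex 1F)
  complement₀₁ = complementary (proj₂ edge₀₁) covered₀₁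
    where
    covered₀₁ : ∀ f → fadj g f (vertex 0F) ≡ true ⊎ fadj g f (vertex 1F) ≡ true
    covered₀₁ f with slim-neighbour f
    ... | 0F , f0 = inj₁ f0
    ... | 1F , f1 = inj₂ f1
    ... | 2F , f2 = covered₂ f2

  𝔮-embedding₂₁ : Embedding g Whole Whole 𝔮
  𝔮-embedding₂₁ =
    𝔮-embedding (𝔮-slim ∘ inject₁) (λ e → inject₁-injective (𝔮-slim-injective e))
      (λ f → fadj g f (vertex 0F)) (λ f → fadj g f (vertex 2F)) (trace₀₂-injective complement₀₁)
      adjacency fat-adjacency
    where
    adjacency : ∀ i j → qAdj (𝔮-slim (inject₁ i)) (𝔮-slim (inject₁ j)) ≡ adj g (vertex i) (vertex j)
    adjacency 0F 0F = sym (adj-irrefl g _)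
    adjacency 0F 1F = sym (proj₁ edge₀₁)
    adjacency 0F 2F = sym (trans (adj-sym g _ _) (proj₁ meets₂₀))
    adjacency 1F 0F = sym (trans (adj-sym g _ _) (proj₁ edge₀₁))
    adjacency 1F 1F = sym (adj-irrefl g _)
    adjacency 1F 2F = sym (trans (adj-sym g _ _) (proj₁ meets₂₁))
    adjacency 2F 0F = sym (proj₁ meets₂₀)
    adjacency 2F 1F = sym (proj₁ meets₂₁)
    adjacency 2F 2F = sym (adj-irrefl g _)

    fat-adjacency : ∀ f i → qFadj (𝔮-fat (fadj g f (vertex 0F)) (fadj g f (vertex 2F)))
                                  (𝔮-slim (inject₁ i)) ≡ fadj g f (vertex i)
    fat-adjacency f 0F = proj₁ (𝔮-fat-adjacency _ _)
    fat-adjacency f 1F = trans (proj₂ (proj₂ (proj₂ (𝔮-fat-adjacency _ _)))) (sym (complement₀₁ f))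
    fat-adjacency f 2F = proj₁ (proj₂ (𝔮-fat-adjacency _ _))

module SpecialBlock22 {g : HoffmanGraph} (si : SpecialIs g 4 (blockMat 2 2)) where
  open EdgeBlock {g} 1 si
  open Opposite 3F (special-vertex 3F 0F) (special-vertex 3F 1F)
    renaming (meets₀ to meets₃₀; meets₁ to meets₃₁; covered to covered₃)

  edge₂₃ : adj g (vertex 2F) (vertex 3F) ≡ true × commonFat g (vertex 2F) (vertex 3F) ≡ 0
  edge₂₃ = special≡1ℤ (special-vertex 2F 3F)

  complement₀₁ : Complementary g (vertex 0F) (vertex 1F)
  complement₀₁ = complementary (proj₂ edge₀₁) covered₀₁
    where
    covered₀₁ : ∀ f → fadj g f (vertex 0F) ≡ true ⊎ fadj g f (vertex 1F) ≡ true
    covered₀₁ f with slim-neighbour f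
    ... | 0F , f0 = inj₁ f0
    ... | 1F , f1 = inj₂ f1
    ... | 2F , f2 = covered₂ f2
    ... | 3F , f3 = covered₃ f3

  complement₂₃ : Complementary g (vertex 2F) (vertex 3F)
  complement₂₃ = complementary (proj₂ edge₂₃) covered₂₃
    where
    covered₂₃ : ∀ f → fadj g f (vertex 2F) ≡ true ⊎ fadj g f (vertex 3F) ≡ true
    covered₂₃ f with slim-neighbour f
    ... | 0F , f0 = covered-by (two-fat 0F) (trans (commonFat-sym _ _) (proj₂ meets₂₀))
                      (trans (commonFat-sym _ _) (proj₂ meets₃₀)) (proj₂ edge₂₃) f0
    ... | 1F , f1 = covered-by (two-fat 1F) (trans (commonFat-sym _ _) (proj₂ meets₂₁))
                      (trans (commonFat-sym _ _) (proj₂ meets₃₁)) (proj₂ edge₂₃) f1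
    ... | 2F , f2 = inj₁ f2
    ... | 3F , f3 = inj₂ f3

  𝔮-embedding₂₂ : Embedding g Whole Whole 𝔮
  𝔮-embedding₂₂ =
    𝔮-embedding 𝔮-slim 𝔮-slim-injective
      (λ f → fadj g f (vertex 0F)) (λ f → fadj g f (vertex 2F)) (trace₀₂-injective complement₀₁)
      adjacency fat-adjacency
    where
    adjacency : ∀ i j → qAdj (𝔮-slim i) (𝔮-slim j) ≡ adj g (vertex i) (vertex j)
    adjacency 0F 0F = sym (adj-irrefl g _)
    adjacency 0F 1F = sym (proj₁ edge₀₁)
    adjacency 0F 2F = sym (trans (adj-sym g _ _) (proj₁ meets₂₀))
    adjacency 0F 3F = sym (trans (adj-sym g _ _) (proj₁ meets₃₀))
    adjacency 1F 0F = sym (trans (adj-sym g _ _) (proj₁ edge₀₁))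
    adjacency 1F 1F = sym (adj-irrefl g _)
    adjacency 1F 2F = sym (trans (adj-sym g _ _) (proj₁ meets₂₁))
    adjacency 1F 3F = sym (trans (adj-sym g _ _) (proj₁ meets₃₁))
    adjacency 2F 0F = sym (proj₁ meets₂₀)
    adjacency 2F 1F = sym (proj₁ meets₂₁)
    adjacency 2F 2F = sym (adj-irrefl g _)
    adjacency 2F 3F = sym (proj₁ edge₂₃)
    adjacency 3F 0F = sym (proj₁ meets₃₀)
    adjacency 3F 1F = sym (proj₁ meets₃₁)
    adjacency 3F 2F = sym (trans (adj-sym g _ _) (proj₁ edge₂₃))
    adjacency 3F 3F = sym (adj-irrefl g _)

    fat-adjacency : ∀ f i → qFadj (𝔮-fat (fadj g f (vertex 0F)) (fadj g f (vertex 2F))) (𝔮-slim i) ≡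
                            fadj g f (vertex i)
    fat-adjacency f 0F = proj₁ (𝔮-fat-adjacency _ _)
    fat-adjacency f 1F = trans (proj₂ (proj₂ (proj₂ (𝔮-fat-adjacency _ _)))) (sym (complement₀₁ f))
    fat-adjacency f 2F = proj₁ (proj₂ (𝔮-fat-adjacency _ _))
    fat-adjacency f 3F = trans (proj₁ (proj₂ (proj₂ (𝔮-fat-adjacency _ _)))) (sym (complement₂₃ f))

blockMat-swap : ∀ i j → blockMat 1 2 i j ≡ blockMat 2 1 (transpose 0F 2F ⟨$⟩ʳ i) (transpose 0F 2F ⟨$⟩ʳ j)
blockMat-swap 0F 0F = refl
blockMat-swap 0F 1F = refl
blockMat-swap 0F 2F = refl
blockMat-swap 1F 0F = refl
blockMat-swap 1F 1F = refl
blockMat-swap 1F 2F = refl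
blockMat-swap 2F 0F = refl
blockMat-swap 2F 1F = refl
blockMat-swap 2F 2F = refl

swap-sides : ∀ {g} → SpecialIs g 3 (blockMat 1 2) → SpecialIs g 3 (blockMat 2 1)
swap-sides (π , S) =
  transpose 0F 2F ↔-∘ π , λ s t → trans (S s t) (blockMat-swap (Inverse.to π s) (Inverse.to π t))

G2⇒EmbedsIn-HQD : ∀ {g} → G2 g → EmbedsIn HQD g
G2⇒EmbedsIn-HQD {g} (_ , _ , inj₁ si) = h3 , inj₁ refl , SpecialMinus3.h3-embedding {g} si
G2⇒EmbedsIn-HQD {g} (_ , _ , inj₂ (_ , _ , inj₁ refl , inj₁ refl , si)) =
  SpecialBlock11.embeds-in-HQD {g} si
G2⇒EmbedsIn-HQD {g} (_ , _ , inj₂ (_ , _ , inj₂ refl , inj₁ refl , si)) =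
  𝔮 , inj₂ (inj₁ refl) , SpecialBlock21.𝔮-embedding₂₁ {g} si
G2⇒EmbedsIn-HQD {g} (_ , _ , inj₂ (_ , _ , inj₁ refl , inj₂ refl , si)) =
  𝔮 , inj₂ (inj₁ refl) , SpecialBlock21.𝔮-embedding₂₁ {g} (swap-sides {g} si)
G2⇒EmbedsIn-HQD {g} (_ , _ , inj₂ (_ , _ , inj₂ refl , inj₂ refl , si)) =
  𝔮 , inj₂ (inj₁ refl) , SpecialBlock22.𝔮-embedding₂₂ {g} si

lemma2p17 : ∀ (h : HoffmanGraph) → IsLine G2 h → IsLine HQD h
lemma2p17 h = IsLine-mono G2⇒EmbedsIn-HQD
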